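{- Let $a_1,b_1,a_2,b_2$ be complex numbers, $p_1,p_2,q_1,q_2$ non-negative integers, and $l$ an integer with $0\le l\le p_1+p_2+q_1+q_2$. Then $$S_{a_1,b_1}^{a_2,b_2,q_1+q_2}(p_1+p_2,l)=\sum_{m=0}^{p_2+q_2}S_{a_1,b_1}^{a_2,b_2,q_2}(p_2,m)\,S_{a_1,a_1m+b_1}^{a_2,a_2m+b_2,q_1}(p_1,l-m).$$
   Context: For complex numbers $a_1,b_1,a_2,b_2$, non-negative integers $p_1,p_2$ and a non-negative integer $k$, the generalized Stirling number of the second kind is $$S_{a_1,b_1}^{a_2,b_2,p_2}(p_1,k)=\frac{1}{k!}\sum_{j=0}^{k}(-1)^j\binom{k}{j}\bigl(a_1(k-j)+b_1\bigr)^{p_1}\bigl(a_2(k-j)+b_2\bigr)^{p_2},$$ with $0^0=1$; it vanishes for $k>p_1+p_2$ and is set to $0$ for negative $k$. -}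

module Defs where

open import Level using (_⊔_)
open import Algebra.Bundles using (CommutativeRing)
open import Data.Nat using (ℕ; zero; suc; _∸_; _!)
open import Data.Nat.Combinatorics using (_C_)
open import Data.Integer using (ℤ; +_; -[1+_])

-- A commutative ring in which k! · 1 is invertible for every k
-- (i.e. a ℚ-algebra); ℂ is the motivating instance.
module _ {c ℓ} (R : CommutativeRing c ℓ) where
  open CommutativeRing R

  natR : ℕ → Carrier
  natR zero    = 0#
  natR (suc n) = 1# + natR n

  pow : Carrier → ℕ → Carrier
  pow x zero    = 1#
  pow x (suc n) = x * pow x n

  sumTo : ℕ → (ℕ → Carrier) → Carrier
  sumTo zero    f = f 0
  sumTo (suc n) f = sumTo n f + f (suc n)

  record FactorialInverses : Set (c ⊔ ℓ) where
    field
      invFact    : ℕ → Carrier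
      invFact-ok : ∀ k → natR (k !) * invFact k ≈ 1#

module GenStirling {c ℓ} (R : CommutativeRing c ℓ) (FI : FactorialInverses R) where
  open CommutativeRing R
  open FactorialInverses FI

  -- S_{a1,b1}^{a2,b2,p2}(p1,k)
  --  = (1/k!) Σ_{j=0}^{k} (-1)^j C(k,j) (a1(k-j)+b1)^p1 (a2(k-j)+b2)^p2
  S : (a1 b1 a2 b2 : Carrier) (p2 p1 k : ℕ) → Carrier
  S a1 b1 a2 b2 p2 p1 k =
    invFact k * sumTo R k (λ j →
      pow R (- 1#) j * natR R (k C j)
        * pow R (a1 * natR R (k ∸ j) + b1) p1
        * pow R (a2 * natR R (k ∸ j) + b2) p2)

  Sℤ : (a1 b1 a2 b2 : Carrier) (p2 p1 : ℕ) (k : ℤ) → Carrier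
  Sℤ a1 b1 a2 b2 p2 p1 (+ k)      = S a1 b1 a2 b2 p2 p1 k
  Sℤ a1 b1 a2 b2 p2 p1 -[1+ n ]   = 0#

module Submission where

open import Defs
open import Algebra.Bundles using (CommutativeRing)
open import Data.Nat using (ℕ; _≤_)
import Data.Integer
open Data.Integer using (+_)

open import Data.Nat as ℕ using (zero; suc; _<_; z≤n; s≤s; _∸_; _!)
import Data.Nat.Properties as ℕₚ
open import Data.Nat.Combinatorics
  using (_C_; nCk≡n!/k![n-k]!; k![n∸k]!∣n!; nCk+nC[k+1]≡[n+1]C[k+1]; k>n⇒nCk≡0)
open import Data.Nat.DivMod using (m/n*n≡m)
import Data.Integer as ℤ
import Data.Integer.Properties as ℤₚ
open import Data.Sum using (inj₁; inj₂)
open import Relation.Binary.PropositionalEquality as ≡ using (_≡_)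
open import Relation.Nullary using (yes; no)

-- Writing f(x) = (a₁x + b₁)^p (a₂x + b₂)^q, the alternating binomial sum defining
-- S(p, k) is k! S(p, k) = Δᵏ f(0) for the forward difference Δ f(x) = f(x+1) - f(x).
-- The left-hand side is Δˡ(g h)(0)/l! with g carrying the exponents p₂, q₂ and h the
-- exponents p₁, q₁, and the Leibniz rule Δˡ(g h)(0) = Σₘ C(l,m) Δᵐ g(0) Δˡ⁻ᵐ h(m)
-- splits it into the products on the right, because h(· + m) is the f of the shifted
-- parameters a₁m + b₁, a₂m + b₂. The sum over m may run to p₂ + q₂ instead of l since
-- g has degree p₂ + q₂ while the terms with m > l vanish.

nCk*[k!*[n∸k]!]≡n! : ∀ {n k} → k ≤ n → (n C k) ℕ.* (k ! ℕ.* (n ∸ k) !) ≡ n !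
nCk*[k!*[n∸k]!]≡n! {n} {k} k≤n = ≡.trans
  (≡.cong (ℕ._* (k ! ℕ.* (n ∸ k) !)) (nCk≡n!/k![n-k]! k≤n))
  (m/n*n≡m {{ℕₚ._!*_!≢0 k (n ∸ k)}} (k![n∸k]!∣n! k≤n))

module Properties {c ℓ} (R : CommutativeRing c ℓ) where
  open CommutativeRing R
  open import Algebra.Properties.Semiring.Mult semiring using (_×_; ×-homo-+; ×1-homo-*)
  open import Algebra.Properties.Semiring.Exp semiring using (_^_; ^-homo-*; ^-congˡ)
  open import Algebra.Properties.AbelianGroup +-abelianGroup using (⁻¹-∙-comm)
  open import Algebra.Solver.Ring.NaturalCoefficients.Default commutativeSemiring
  open import Relation.Binary.Reasoning.Setoid setoid

  natR≡×1 : ∀ n → natR R n ≡ n × 1#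
  natR≡×1 zero    = ≡.refl
  natR≡×1 (suc n) = ≡.cong (_+_ 1#) (natR≡×1 n)

  natR-homo-+ : ∀ m n → natR R (m ℕ.+ n) ≈ natR R m + natR R n
  natR-homo-+ m n rewrite natR≡×1 (m ℕ.+ n) | natR≡×1 m | natR≡×1 n = ×-homo-+ 1# m n

  natR-homo-* : ∀ m n → natR R (m ℕ.* n) ≈ natR R m * natR R n
  natR-homo-* m n rewrite natR≡×1 (m ℕ.* n) | natR≡×1 m | natR≡×1 n = ×1-homo-* m n

  pow≡^ : ∀ x n → pow R x n ≡ x ^ n
  pow≡^ x zero    = ≡.refl
  pow≡^ x (suc n) = ≡.cong (x *_) (pow≡^ x n)

  pow-homo-+ : ∀ x m n → pow R x (m ℕ.+ n) ≈ pow R x m * pow R x n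
  pow-homo-+ x m n rewrite pow≡^ x (m ℕ.+ n) | pow≡^ x m | pow≡^ x n = ^-homo-* x m n

  pow-congˡ : ∀ n {x y} → x ≈ y → pow R x n ≈ pow R y n
  pow-congˡ n {x} {y} x≈y rewrite pow≡^ x n | pow≡^ y n = ^-congˡ n x≈y

  sumTo-cong≤ : ∀ n {F G : ℕ → Carrier} → (∀ i → i ≤ n → F i ≈ G i) → sumTo R n F ≈ sumTo R n G
  sumTo-cong≤ zero    F≈G = F≈G 0 z≤n
  sumTo-cong≤ (suc n) F≈G =
    +-cong (sumTo-cong≤ n (λ i i≤n → F≈G i (ℕₚ.m≤n⇒m≤1+n i≤n))) (F≈G (suc n) ℕₚ.≤-refl)

  sumTo-cong : ∀ n {F G : ℕ → Carrier} → (∀ i → F i ≈ G i) → sumTo R n F ≈ sumTo R n G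
  sumTo-cong n F≈G = sumTo-cong≤ n (λ i _ → F≈G i)

  sumTo-distrib-+ : ∀ n (F G : ℕ → Carrier) →
    sumTo R n (λ i → F i + G i) ≈ sumTo R n F + sumTo R n G
  sumTo-distrib-+ zero    F G = refl
  sumTo-distrib-+ (suc n) F G = begin
    sumTo R n (λ i → F i + G i) + (F (suc n) + G (suc n))
      ≈⟨ +-congʳ (sumTo-distrib-+ n F G) ⟩
    (sumTo R n F + sumTo R n G) + (F (suc n) + G (suc n))
      ≈⟨ solve 4 (λ a b c d → (a :+ b) :+ (c :+ d) := (a :+ c) :+ (b :+ d)) refl _ _ _ _ ⟩
    (sumTo R n F + F (suc n)) + (sumTo R n G + G (suc n)) ∎

  sumTo-distrib-sub : ∀ n (F G : ℕ → Carrier) →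
    sumTo R n (λ i → F i - G i) ≈ sumTo R n F - sumTo R n G
  sumTo-distrib-sub zero    F G = refl
  sumTo-distrib-sub (suc n) F G = begin
    sumTo R n (λ i → F i - G i) + (F (suc n) - G (suc n))
      ≈⟨ +-congʳ (sumTo-distrib-sub n F G) ⟩
    (sumTo R n F - sumTo R n G) + (F (suc n) - G (suc n))
      ≈⟨ solve 4 (λ a b c d → (a :+ b) :+ (c :+ d) := (a :+ c) :+ (b :+ d)) refl _ _ _ _ ⟩
    (sumTo R n F + F (suc n)) + (- sumTo R n G + - G (suc n))
      ≈⟨ +-congˡ (⁻¹-∙-comm _ _) ⟩
    (sumTo R n F + F (suc n)) - (sumTo R n G + G (suc n)) ∎

  *-distribˡ-sumTo : ∀ n x (F : ℕ → Carrier) → x * sumTo R n F ≈ sumTo R n (λ i → x * F i)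
  *-distribˡ-sumTo zero    x F = refl
  *-distribˡ-sumTo (suc n) x F = trans (distribˡ x _ _) (+-congʳ (*-distribˡ-sumTo n x F))

  sumTo-head : ∀ n (F : ℕ → Carrier) → sumTo R (suc n) F ≈ F 0 + sumTo R n (λ i → F (suc i))
  sumTo-head zero    F = refl
  sumTo-head (suc n) F = trans (+-congʳ (sumTo-head n F)) (+-assoc _ _ _)

  sumTo-zero : ∀ n {F : ℕ → Carrier} → (∀ i → F i ≈ 0#) → sumTo R n F ≈ 0#
  sumTo-zero zero    F≈0 = F≈0 0
  sumTo-zero (suc n) F≈0 = trans (+-cong (sumTo-zero n F≈0) (F≈0 (suc n))) (+-identityˡ 0#)

  sumTo-truncate : ∀ {n N} (F : ℕ → Carrier) → n ≤ N → (∀ i → n < i → F i ≈ 0#) →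
    sumTo R N F ≈ sumTo R n F
  sumTo-truncate {N = zero}  F z≤n   _   = refl
  sumTo-truncate {N = suc N} F n≤1+N F≈0 with ℕₚ.m≤n⇒m<n∨m≡n n≤1+N
  ... | inj₂ ≡.refl      = refl
  ... | inj₁ (s≤s n≤N) =
    trans (+-cong (sumTo-truncate F n≤N F≈0) (F≈0 (suc N) (s≤s n≤N))) (+-identityʳ _)

  sumTo-cong-truncated : ∀ l N (F G : ℕ → Carrier) → (∀ m → m ≤ l → F m ≈ G m) →
    (∀ m → N < m → F m ≈ 0#) → (∀ m → l < m → G m ≈ 0#) → sumTo R l F ≈ sumTo R N G
  sumTo-cong-truncated l N F G F≈G F≈0 G≈0 with ℕₚ.≤-total l N
  ... | inj₁ l≤N = trans (sumTo-cong≤ l F≈G) (sym (sumTo-truncate G l≤N G≈0))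
  ... | inj₂ N≤l = trans (sumTo-truncate F N≤l F≈0)
                         (sumTo-cong≤ N (λ m m≤N → F≈G m (ℕₚ.≤-trans m≤N N≤l)))

  sumTo-pascal : ∀ n (U : ℕ → Carrier) →
    sumTo R (suc n) (λ m → natR R (suc n C m) * U m) ≈
    sumTo R n (λ m → natR R (n C m) * U (suc m)) + sumTo R n (λ m → natR R (n C m) * U m)
  sumTo-pascal n U = begin
    sumTo R (suc n) (λ m → C₁ m * U m)
      ≈⟨ sumTo-head n _ ⟩
    C₀ 0 * U 0 + sumTo R n (λ m → C₁ (suc m) * U (suc m))
      ≈⟨ +-congˡ (sumTo-cong n (λ m → *-congʳ (pascal m))) ⟩
    C₀ 0 * U 0 + sumTo R n (λ m → (C₀ m + C₀ (suc m)) * U (suc m))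
      ≈⟨ +-congˡ (trans (sumTo-cong n (λ m → distribʳ _ _ _)) (sumTo-distrib-+ n _ _)) ⟩
    C₀ 0 * U 0 + (sumTo R n (λ m → C₀ m * U (suc m)) + sumTo R n (λ m → C₀ (suc m) * U (suc m)))
      ≈⟨ solve 3 (λ a b c → a :+ (b :+ c) := b :+ (a :+ c)) refl _ _ _ ⟩
    sumTo R n (λ m → C₀ m * U (suc m)) + (C₀ 0 * U 0 + sumTo R n (λ m → C₀ (suc m) * U (suc m)))
      ≈⟨ +-congˡ (sym (sumTo-head n (λ m → C₀ m * U m))) ⟩
    sumTo R n (λ m → C₀ m * U (suc m)) + sumTo R (suc n) (λ m → C₀ m * U m)
      ≈⟨ +-congˡ (sumTo-truncate _ (ℕₚ.n≤1+n n) C₀-vanishes) ⟩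
    sumTo R n (λ m → C₀ m * U (suc m)) + sumTo R n (λ m → C₀ m * U m) ∎
    where
    C₀ C₁ : ℕ → Carrier
    C₀ m = natR R (n C m)
    C₁ m = natR R (suc n C m)
    pascal : ∀ m → C₁ (suc m) ≈ C₀ m + C₀ (suc m)
    pascal m = trans (reflexive (≡.cong (natR R) (≡.sym (nCk+nC[k+1]≡[n+1]C[k+1] n m))))
                     (natR-homo-+ (n C m) _)
    C₀-vanishes : ∀ m → n < m → C₀ m * U m ≈ 0#
    C₀-vanishes m n<m = trans (*-congʳ (reflexive (≡.cong (natR R) (k>n⇒nCk≡0 n<m)))) (zeroˡ _)

module ForwardDifference {c ℓ} (R : CommutativeRing c ℓ) where
  open CommutativeRing R
  open Properties R
  open import Algebra.Properties.Ring ring using (-1*x≈-x; -‿distribʳ-*; x[y-z]≈xy-xz)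
  open import Algebra.Properties.AbelianGroup +-abelianGroup using (xyx⁻¹≈y)
  open import Algebra.Solver.Ring.NaturalCoefficients.Default commutativeSemiring
  open import Relation.Binary.Reasoning.Setoid setoid

  Δ : (ℕ → Carrier) → ℕ → Carrier
  Δ f x = f (suc x) - f x

  Δ^ : ℕ → (ℕ → Carrier) → ℕ → Carrier
  Δ^ zero    f = f
  Δ^ (suc k) f = Δ (Δ^ k f)

  Δ^-cong : ∀ k {f g : ℕ → Carrier} → (∀ x → f x ≈ g x) → ∀ x → Δ^ k f x ≈ Δ^ k g x
  Δ^-cong zero    f≈g x = f≈g x
  Δ^-cong (suc k) f≈g x = +-cong (Δ^-cong k f≈g (suc x)) (-‿cong (Δ^-cong k f≈g x))

  Δ^-suc : ∀ k f x → Δ^ (suc k) f x ≈ Δ^ k (Δ f) x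
  Δ^-suc zero    f x = refl
  Δ^-suc (suc k) f x = +-cong (Δ^-suc k f (suc x)) (-‿cong (Δ^-suc k f x))

  Δ^-shift : ∀ k m f x → Δ^ k (λ y → f (y ℕ.+ m)) x ≈ Δ^ k f (x ℕ.+ m)
  Δ^-shift zero    m f x = refl
  Δ^-shift (suc k) m f x = +-cong (Δ^-shift k m f (suc x)) (-‿cong (Δ^-shift k m f x))

  Δ^-zero : ∀ k {f : ℕ → Carrier} → (∀ x → f x ≈ 0#) → ∀ x → Δ^ k f x ≈ 0#
  Δ^-zero zero    f≈0 x = f≈0 x
  Δ^-zero (suc k) f≈0 x =
    trans (+-cong (Δ^-zero k f≈0 (suc x)) (-‿cong (Δ^-zero k f≈0 x))) (-‿inverseʳ 0#)

  alternatingSum : ℕ → (ℕ → Carrier) → Carrier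
  alternatingSum k f = sumTo R k (λ j → natR R (k C j) * (pow R (- 1#) j * f (k ∸ j)))

  alternatingSum-suc : ∀ k f → alternatingSum (suc k) f ≈ alternatingSum k (Δ f)
  alternatingSum-suc k f = begin
    alternatingSum (suc k) f
      ≈⟨ sumTo-pascal k U ⟩
    sumTo R k (λ j → natR R (k C j) * U (suc j)) + sumTo R k (λ j → natR R (k C j) * U j)
      ≈⟨ sym (sumTo-distrib-+ k _ _) ⟩
    sumTo R k (λ j → natR R (k C j) * U (suc j) + natR R (k C j) * U j)
      ≈⟨ sumTo-cong≤ k pascal-terms ⟩
    alternatingSum k (Δ f) ∎
    where
    U : ℕ → Carrier
    U j = pow R (- 1#) j * f (suc k ∸ j)
    pascal-terms : ∀ j → j ≤ k →
      natR R (k C j) * U (suc j) + natR R (k C j) * U j ≈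
      natR R (k C j) * (pow R (- 1#) j * Δ f (k ∸ j))
    pascal-terms j j≤k = begin
      b * ((- 1# * s) * f (k ∸ j)) + b * (s * f (suc k ∸ j))
        ≈⟨ +-congˡ (*-congˡ (*-congˡ (reflexive (≡.cong f (ℕₚ.+-∸-assoc 1 j≤k))))) ⟩
      b * ((- 1# * s) * f (k ∸ j)) + b * (s * f (suc (k ∸ j)))
        ≈⟨ solve 5 (λ c m s u v → c :* ((m :* s) :* u) :+ c :* (s :* v) := c :* (s :* (v :+ m :* u)))
                   refl b (- 1#) s (f (k ∸ j)) (f (suc (k ∸ j))) ⟩
      b * (s * (f (suc (k ∸ j)) + - 1# * f (k ∸ j)))
        ≈⟨ *-congˡ (*-congˡ (+-congˡ (-1*x≈-x _))) ⟩
      b * (s * Δ f (k ∸ j)) ∎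
      where
      b s : Carrier
      b = natR R (k C j)
      s = pow R (- 1#) j

  alternatingSum≈Δ^ : ∀ k f → alternatingSum k f ≈ Δ^ k f 0
  alternatingSum≈Δ^ zero    f = solve 1 (λ x → (con 1 :+ con 0) :* (con 1 :* x) := x) refl (f 0)
  alternatingSum≈Δ^ (suc k) f =
    trans (alternatingSum-suc k f) (trans (alternatingSum≈Δ^ k (Δ f)) (sym (Δ^-suc k f 0)))

  *-sub-* : ∀ a a′ b b′ → a′ * b′ - a * b ≈ (a′ - a) * b′ + a * (b′ - b)
  *-sub-* a a′ b b′ = sym (begin
    (a′ - a) * b′ + a * (b′ - b)
      ≈⟨ solve 6 (λ a a′ -a b b′ -b → (a′ :+ -a) :* b′ :+ a :* (b′ :+ -b) :=
                                      a′ :* b′ :+ (b′ :* (-a :+ a) :+ a :* -b))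
                 refl a a′ (- a) b b′ (- b) ⟩
    a′ * b′ + (b′ * (- a + a) + a * - b)
      ≈⟨ +-congˡ (+-cong (trans (*-congˡ (-‿inverseˡ a)) (zeroʳ b′)) (sym (-‿distribʳ-* a b))) ⟩
    a′ * b′ + (0# - a * b)
      ≈⟨ +-congˡ (+-identityˡ _) ⟩
    a′ * b′ - a * b ∎)

  Δ^-* : ∀ n (g h : ℕ → Carrier) x →
    Δ^ n (λ y → g y * h y) x ≈
    sumTo R n (λ m → natR R (n C m) * (Δ^ m g x * Δ^ (n ∸ m) h (x ℕ.+ m)))
  Δ^-* zero g h x =
    trans (solve 2 (λ a b → a :* b := (con 1 :+ con 0) :* (a :* b)) refl (g x) (h x))
          (*-congˡ (*-congˡ (reflexive (≡.cong h (≡.sym (ℕₚ.+-identityʳ x))))))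
  Δ^-* (suc n) g h x = begin
    Δ^ n gh (suc x) - Δ^ n gh x
      ≈⟨ +-cong (Δ^-* n g h (suc x)) (-‿cong (Δ^-* n g h x)) ⟩
    sumTo R n (leibniz (suc x)) - sumTo R n (leibniz x)
      ≈⟨ sym (sumTo-distrib-sub n _ _) ⟩
    sumTo R n (λ m → leibniz (suc x) m - leibniz x m)
      ≈⟨ sumTo-cong≤ n split ⟩
    sumTo R n (λ m → natR R (n C m) * U (suc m) + natR R (n C m) * U m)
      ≈⟨ sumTo-distrib-+ n _ _ ⟩
    sumTo R n (λ m → natR R (n C m) * U (suc m)) + sumTo R n (λ m → natR R (n C m) * U m)
      ≈⟨ sym (sumTo-pascal n U) ⟩
    sumTo R (suc n) (λ m → natR R (suc n C m) * U m) ∎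
    where
    gh : ℕ → Carrier
    gh y = g y * h y
    leibniz : ℕ → ℕ → Carrier
    leibniz y m = natR R (n C m) * (Δ^ m g y * Δ^ (n ∸ m) h (y ℕ.+ m))
    U : ℕ → Carrier
    U m = Δ^ m g x * Δ^ (suc n ∸ m) h (x ℕ.+ m)
    split : ∀ m → m ≤ n →
      leibniz (suc x) m - leibniz x m ≈ natR R (n C m) * U (suc m) + natR R (n C m) * U m
    split m m≤n = begin
      b * (Δ^ m g (suc x) * Δ^ (n ∸ m) h (suc x ℕ.+ m)) - b * (Δ^ m g x * Δ^ (n ∸ m) h (x ℕ.+ m))
        ≈⟨ sym (x[y-z]≈xy-xz _ _ _) ⟩
      b * (Δ^ m g (suc x) * Δ^ (n ∸ m) h (suc x ℕ.+ m) - Δ^ m g x * Δ^ (n ∸ m) h (x ℕ.+ m))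
        ≈⟨ trans (*-congˡ (*-sub-* _ _ _ _)) (distribˡ _ _ _) ⟩
      b * (Δ^ (suc m) g x * Δ^ (n ∸ m) h (suc x ℕ.+ m)) + b * (Δ^ m g x * Δ^ (suc (n ∸ m)) h (x ℕ.+ m))
        ≡⟨ ≡.cong₂ (λ y k → b * (Δ^ (suc m) g x * Δ^ (n ∸ m) h y) + b * (Δ^ m g x * Δ^ k h (x ℕ.+ m)))
                   (≡.sym (ℕₚ.+-suc x m)) (≡.sym (ℕₚ.+-∸-assoc 1 m≤n)) ⟩
      b * U (suc m) + b * U m ∎
      where
      b : Carrier
      b = natR R (n C m)

  DegreeAtMost : ℕ → (ℕ → Carrier) → Set ℓ
  DegreeAtMost d f = ∀ k x → d < k → Δ^ k f x ≈ 0#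

  degree-const : ∀ a → DegreeAtMost 0 (λ _ → a)
  degree-const a (suc k) x _ = trans (Δ^-suc k _ x) (Δ^-zero k (λ _ → -‿inverseʳ a) x)

  degree-affine : ∀ a b → DegreeAtMost 1 (λ x → a * natR R x + b)
  degree-affine a b (suc k) x (s≤s 0<k) =
    trans (Δ^-suc k _ x) (trans (Δ^-cong k slope x) (degree-const a k x 0<k))
    where
    slope : ∀ y → Δ (λ x → a * natR R x + b) y ≈ a
    slope y = trans (+-congʳ (solve 3 (λ a n b → a :* (con 1 :+ n) :+ b := (a :* n :+ b) :+ a)
                                      refl a (natR R y) b))
                    (xyx⁻¹≈y _ a)

  degree-* : ∀ d e {g h : ℕ → Carrier} → DegreeAtMost d g → DegreeAtMost e h →
    DegreeAtMost (d ℕ.+ e) (λ y → g y * h y)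
  degree-* d e {g} {h} deg-g deg-h k x d+e<k = trans (Δ^-* k g h x) (sumTo-zero k term≈0)
    where
    term≈0 : ∀ m → natR R (k C m) * (Δ^ m g x * Δ^ (k ∸ m) h (x ℕ.+ m)) ≈ 0#
    term≈0 m with d ℕₚ.<? m
    ... | yes d<m = trans (*-congˡ (trans (*-congʳ (deg-g m x d<m)) (zeroˡ _))) (zeroʳ _)
    ... | no  d≮m = trans (*-congˡ (trans (*-congˡ (deg-h (k ∸ m) (x ℕ.+ m) e<k∸m)) (zeroʳ _))) (zeroʳ _)
      where
      m+e<k : m ℕ.+ e < k
      m+e<k = ℕₚ.≤-<-trans (ℕₚ.+-monoˡ-≤ e (ℕₚ.≮⇒≥ d≮m)) d+e<k
      e<k∸m : e < k ∸ m
      e<k∸m = ≡.subst (_< k ∸ m) (ℕₚ.m+n∸m≡n m e) (ℕₚ.∸-monoˡ-< m+e<k (ℕₚ.m≤m+n m e))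

  degree-pow : ∀ {f : ℕ → Carrier} → DegreeAtMost 1 f → ∀ p → DegreeAtMost p (λ x → pow R (f x) p)
  degree-pow deg-f zero    = degree-const 1#
  degree-pow deg-f (suc p) = degree-* 1 p deg-f (degree-pow deg-f p)

module GenStirlingProperties {c ℓ} (R : CommutativeRing c ℓ) (FI : FactorialInverses R) where
  open CommutativeRing R
  open FactorialInverses FI
  open GenStirling R FI
  open Properties R
  open ForwardDifference R
  open import Algebra.Solver.Ring.NaturalCoefficients.Default commutativeSemiring
  open import Relation.Binary.Reasoning.Setoid setoid

  affinePowers : (a1 b1 a2 b2 : Carrier) (q p x : ℕ) → Carrier
  affinePowers a1 b1 a2 b2 q p x = pow R (a1 * natR R x + b1) p * pow R (a2 * natR R x + b2) q

  S≈invFact*Δ^ : ∀ a1 b1 a2 b2 q p k →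
    S a1 b1 a2 b2 q p k ≈ invFact k * Δ^ k (affinePowers a1 b1 a2 b2 q p) 0
  S≈invFact*Δ^ a1 b1 a2 b2 q p k = *-congˡ (trans (sumTo-cong k reassoc) (alternatingSum≈Δ^ k _))
    where
    reassoc : ∀ j →
      pow R (- 1#) j * natR R (k C j) * pow R (a1 * natR R (k ∸ j) + b1) p * pow R (a2 * natR R (k ∸ j) + b2) q
      ≈ natR R (k C j) * (pow R (- 1#) j * affinePowers a1 b1 a2 b2 q p (k ∸ j))
    reassoc j = solve 4 (λ s b u v → s :* b :* u :* v := b :* (s :* (u :* v))) refl _ _ _ _

  affinePowers-shift : ∀ a1 b1 a2 b2 q p m y →
    affinePowers a1 (a1 * natR R m + b1) a2 (a2 * natR R m + b2) q p y ≈
    affinePowers a1 b1 a2 b2 q p (y ℕ.+ m)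
  affinePowers-shift a1 b1 a2 b2 q p m y =
    *-cong (pow-congˡ p (affine-shift a1 b1)) (pow-congˡ q (affine-shift a2 b2))
    where
    affine-shift : ∀ a b → a * natR R y + (a * natR R m + b) ≈ a * natR R (y ℕ.+ m) + b
    affine-shift a b = trans (solve 4 (λ a y m b → a :* y :+ (a :* m :+ b) := a :* (y :+ m) :+ b) refl a _ _ b)
                             (+-congʳ (*-congˡ (sym (natR-homo-+ y m))))

  S-shifted≈invFact*Δ^ : ∀ a1 b1 a2 b2 q p m k →
    S a1 (a1 * natR R m + b1) a2 (a2 * natR R m + b2) q p k ≈
    invFact k * Δ^ k (affinePowers a1 b1 a2 b2 q p) m
  S-shifted≈invFact*Δ^ a1 b1 a2 b2 q p m k = trans (S≈invFact*Δ^ _ _ _ _ q p k)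
    (*-congˡ (trans (Δ^-cong k (affinePowers-shift a1 b1 a2 b2 q p m) 0) (Δ^-shift k m _ 0)))

  affinePowers-+ : ∀ a1 b1 a2 b2 p1 p2 q1 q2 x →
    affinePowers a1 b1 a2 b2 (q1 ℕ.+ q2) (p1 ℕ.+ p2) x ≈
    affinePowers a1 b1 a2 b2 q2 p2 x * affinePowers a1 b1 a2 b2 q1 p1 x
  affinePowers-+ a1 b1 a2 b2 p1 p2 q1 q2 x = trans (*-cong (pow-homo-+ _ p1 p2) (pow-homo-+ _ q1 q2))
    (solve 4 (λ u₁ u₂ v₁ v₂ → (u₁ :* u₂) :* (v₁ :* v₂) := (u₂ :* v₂) :* (u₁ :* v₁))
             refl _ _ _ _)

  affinePowers-degree : ∀ a1 b1 a2 b2 q p → DegreeAtMost (p ℕ.+ q) (affinePowers a1 b1 a2 b2 q p)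
  affinePowers-degree a1 b1 a2 b2 q p =
    degree-* p q (degree-pow (degree-affine a1 b1) p) (degree-pow (degree-affine a2 b2) q)

  invFact*binomial : ∀ l m → m ≤ l → invFact l * natR R (l C m) ≈ invFact m * invFact (l ∸ m)
  invFact*binomial l m m≤l = begin
    iₗ * b                             ≈⟨ sym (trans (*-identityʳ _) (*-identityʳ _)) ⟩
    iₗ * b * 1# * 1#                   ≈⟨ sym (*-cong (*-congˡ (invFact-ok m)) (invFact-ok (l ∸ m))) ⟩
    iₗ * b * (fₘ * iₘ) * (fₗ₋ₘ * iₗ₋ₘ)
      ≈⟨ solve 6 (λ i b f i′ f′ i″ → i :* b :* (f :* i′) :* (f′ :* i″) :=
                                   (b :* (f :* f′)) :* i :* (i′ :* i″)) refl _ _ _ _ _ _ ⟩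
    (b * (fₘ * fₗ₋ₘ)) * iₗ * (iₘ * iₗ₋ₘ) ≈⟨ *-congʳ (*-congʳ (sym factorials)) ⟩
    natR R (l !) * iₗ * (iₘ * iₗ₋ₘ)    ≈⟨ *-congʳ (invFact-ok l) ⟩
    1# * (iₘ * iₗ₋ₘ)                   ≈⟨ *-identityˡ _ ⟩
    iₘ * iₗ₋ₘ                           ∎
    where
    iₗ iₘ iₗ₋ₘ b fₘ fₗ₋ₘ : Carrier
    iₗ   = invFact l
    iₘ   = invFact m
    iₗ₋ₘ = invFact (l ∸ m)
    b    = natR R (l C m)
    fₘ   = natR R (m !)
    fₗ₋ₘ = natR R ((l ∸ m) !)
    factorials : natR R (l !) ≈ b * (fₘ * fₗ₋ₘ)
    factorials = begin
      natR R (l !)                             ≡⟨ ≡.cong (natR R) (≡.sym (nCk*[k!*[n∸k]!]≡n! m≤l)) ⟩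
      natR R ((l C m) ℕ.* (m ! ℕ.* (l ∸ m) !))  ≈⟨ natR-homo-* (l C m) _ ⟩
      b * natR R (m ! ℕ.* (l ∸ m) !)            ≈⟨ *-congˡ (natR-homo-* (m !) ((l ∸ m) !)) ⟩
      b * (fₘ * fₗ₋ₘ)                           ∎

  Sℤ-negative : ∀ a1 b1 a2 b2 q p {l m} → l < m → Sℤ a1 b1 a2 b2 q p (+ l ℤ.- + m) ≈ 0#
  Sℤ-negative a1 b1 a2 b2 q p {l} {m} l<m rewrite ℤₚ.m-n≡m⊖n l m | ℤₚ.⊖-< l<m
    with m ∸ l | ℕₚ.m<n⇒0<n∸m l<m
  ... | suc _ | _ = refl

  Sℤ-nonnegative : ∀ a1 b1 a2 b2 q p {l m} → m ≤ l →
    Sℤ a1 b1 a2 b2 q p (+ l ℤ.- + m) ≈ S a1 b1 a2 b2 q p (l ∸ m)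
  Sℤ-nonnegative a1 b1 a2 b2 q p {l} {m} m≤l rewrite ℤₚ.m-n≡m⊖n l m | ℤₚ.⊖-≥ m≤l = refl

  module Decomposition (a1 b1 a2 b2 : Carrier) (p1 p2 q1 q2 l : ℕ) where
    g h : ℕ → Carrier
    g = affinePowers a1 b1 a2 b2 q2 p2
    h = affinePowers a1 b1 a2 b2 q1 p1

    leibnizTerm stirlingTerm : ℕ → Carrier
    leibnizTerm m = invFact l * (natR R (l C m) * (Δ^ m g 0 * Δ^ (l ∸ m) h m))
    stirlingTerm m =
      S a1 b1 a2 b2 q2 p2 m * Sℤ a1 (a1 * natR R m + b1) a2 (a2 * natR R m + b2) q1 p1 (+ l ℤ.- + m)

    S≈sum-leibnizTerm : S a1 b1 a2 b2 (q1 ℕ.+ q2) (p1 ℕ.+ p2) l ≈ sumTo R l leibnizTerm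
    S≈sum-leibnizTerm = begin
      S a1 b1 a2 b2 (q1 ℕ.+ q2) (p1 ℕ.+ p2) l
        ≈⟨ S≈invFact*Δ^ a1 b1 a2 b2 (q1 ℕ.+ q2) (p1 ℕ.+ p2) l ⟩
      invFact l * Δ^ l (affinePowers a1 b1 a2 b2 (q1 ℕ.+ q2) (p1 ℕ.+ p2)) 0
        ≈⟨ *-congˡ (Δ^-cong l (affinePowers-+ a1 b1 a2 b2 p1 p2 q1 q2) 0) ⟩
      invFact l * Δ^ l (λ x → g x * h x) 0
        ≈⟨ *-congˡ (Δ^-* l g h 0) ⟩
      invFact l * sumTo R l (λ m → natR R (l C m) * (Δ^ m g 0 * Δ^ (l ∸ m) h m))
        ≈⟨ *-distribˡ-sumTo l _ _ ⟩
      sumTo R l leibnizTerm ∎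

    leibnizTerm≈stirlingTerm : ∀ m → m ≤ l → leibnizTerm m ≈ stirlingTerm m
    leibnizTerm≈stirlingTerm m m≤l = begin
      invFact l * (natR R (l C m) * (Δ^ m g 0 * Δ^ (l ∸ m) h m))
        ≈⟨ sym (*-assoc _ _ _) ⟩
      invFact l * natR R (l C m) * (Δ^ m g 0 * Δ^ (l ∸ m) h m)
        ≈⟨ *-congʳ (invFact*binomial l m m≤l) ⟩
      invFact m * invFact (l ∸ m) * (Δ^ m g 0 * Δ^ (l ∸ m) h m)
        ≈⟨ solve 4 (λ i j u v → i :* j :* (u :* v) := i :* u :* (j :* v)) refl _ _ _ _ ⟩
      invFact m * Δ^ m g 0 * (invFact (l ∸ m) * Δ^ (l ∸ m) h m)
        ≈⟨ *-cong (sym (S≈invFact*Δ^ a1 b1 a2 b2 q2 p2 m))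
                  (sym (S-shifted≈invFact*Δ^ a1 b1 a2 b2 q1 p1 m (l ∸ m))) ⟩
      S a1 b1 a2 b2 q2 p2 m * S a1 (a1 * natR R m + b1) a2 (a2 * natR R m + b2) q1 p1 (l ∸ m)
        ≈⟨ *-congˡ (sym (Sℤ-nonnegative _ _ _ _ q1 p1 m≤l)) ⟩
      stirlingTerm m ∎

    leibnizTerm-vanishes : ∀ m → p2 ℕ.+ q2 < m → leibnizTerm m ≈ 0#
    leibnizTerm-vanishes m p2+q2<m = trans (*-congˡ (trans (*-congˡ Δᵐg≈0) (zeroʳ _))) (zeroʳ _)
      where
      Δᵐg≈0 : Δ^ m g 0 * Δ^ (l ∸ m) h m ≈ 0#
      Δᵐg≈0 = trans (*-congʳ (affinePowers-degree a1 b1 a2 b2 q2 p2 m 0 p2+q2<m)) (zeroˡ _)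

    stirlingTerm-vanishes : ∀ m → l < m → stirlingTerm m ≈ 0#
    stirlingTerm-vanishes m l<m = trans (*-congˡ (Sℤ-negative _ _ _ _ q1 p1 l<m)) (zeroʳ _)

proposition2 : ∀ {c ℓ} (R : CommutativeRing c ℓ) (FI : FactorialInverses R)
    → let open CommutativeRing R in
    (a1 b1 a2 b2 : Carrier) (p1 p2 q1 q2 l : ℕ)
    → l ≤ (p1 Data.Nat.+ p2) Data.Nat.+ (q1 Data.Nat.+ q2)
    → GenStirling.S R FI a1 b1 a2 b2 (q1 Data.Nat.+ q2) (p1 Data.Nat.+ p2) l
    ≈ sumTo R (p2 Data.Nat.+ q2) (λ m →
    GenStirling.S R FI a1 b1 a2 b2 q2 p2 m
    * GenStirling.Sℤ R FI a1 (a1 * natR R m + b1) a2 (a2 * natR R m + b2) q1 p1 ((+ l) Data.Integer.- (+ m)))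
proposition2 R FI a1 b1 a2 b2 p1 p2 q1 q2 l _ =
  trans S≈sum-leibnizTerm
        (sumTo-cong-truncated l (p2 ℕ.+ q2) leibnizTerm stirlingTerm
          leibnizTerm≈stirlingTerm leibnizTerm-vanishes stirlingTerm-vanishes)
  where
  open CommutativeRing R using (trans)
  open Properties R using (sumTo-cong-truncated)
  open GenStirlingProperties R FI
  open Decomposition a1 b1 a2 b2 p1 p2 q1 q2 l
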